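{- Let integers $a,x,u,v$ satisfy $3\le a\le x$, $0\le u\le a-3$, and $u+2\le v\le\min(a-1,\,a(x-1)/x)$. Let $\lambda$ consist of $ua+v$ parts equal to $x$ and $v-(u+1)$ parts equal to $ax$, and $n=|\lambda|$ (so $n-1=xa(v-1)+xv-1$). For $0\le i\le n-2$ write $i=\frac{n}{x}r_i+(v-1)p_i+q_i$ with $0\le r_i<x$, $0\le p_i<a+2$, $0\le q_i<v-1$, $0\le(v-1)p_i+q_i<n/x$, and $q_i=0$ whenever $p_i=a+1$. Let $f(i)=ar_i-(xv-1)p_i+xaq_i$ and $F_k=\{i\in\{1,\dots,n-2\}: k=-\lfloor f(i)/(n-1)\rfloor\}$. Then $\{1,\dots,n-2\}=F_0\uplus F_1\uplus F_2$.
   Context: The integers $r_i,p_i,q_i$ are uniquely determined by $i$ via the stated division-with-remainder conditions. -}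

module Defs where

open import Data.Nat using (ℕ; zero; suc; _+_; _*_; _∸_)
open import Data.Nat.DivMod using (_/_)
open import Data.List using (List; replicate; _++_)
open import Data.Nat.ListAction using (sum)
open import Data.Integer using (ℤ; _/ℕ_) renaming (+_ to ℤ+_)

-- The partition λ : (u*a + v) parts equal to x and (v - (u+1)) parts equal to a*x.
-- (v - (u+1)) is truncated subtraction; under the hypothesis u + 2 ≤ v it is exact.
lam : (a x u v : ℕ) → List ℕ
lam a x u v = replicate (u * a + v) x ++ replicate (v ∸ (u + 1)) (a * x)

size : List ℕ → ℕ
size = sum

quot : ℕ → ℕ → ℕ
quot m zero    = 0
quot m (suc d) = m / suc d

floorDiv : ℤ → ℕ → ℤ
floorDiv z zero    = ℤ+ 0
floorDiv z (suc d) = z /ℕ suc d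

fval : (a x v r p q : ℕ) → ℤ
fval a x v r p q =
  Data.Integer._+_ (Data.Integer._-_ (ℤ+ (a * r)) (ℤ+ ((x * v ∸ 1) * p))) (ℤ+ (x * a * q))
  where import Data.Integer

module Submission where

-- With N = n - 1 = x(a(v-1) + v) - 1, write f(i) = P - B where P = a r + x a q and
-- B = (x v - 1) p.  The ranges of r and q give 0 ≤ P < N, and p ≤ a + 1 together
-- with v ≥ 2 gives 0 ≤ B ≤ 2N.  Hence -2N ≤ f(i) < N, so ⌊f(i)/N⌋ ∈ {-2, -1, 0}.

open import Defs
open import Data.Nat using (ℕ; _+_; _*_; _∸_; _≤_; _<_; zero; suc; s≤s; z≤n; z<s; NonZero)
open import Data.Nat.Properties
  using (≤-trans; ≤-pred; m≤n+m; m≤m+n; m<m+n; m∸n≤m; +-comm; *-mono-≤; +-mono-≤; *-monoʳ-≤;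
         m≤n⇒∃[o]m+o≡n; m+n∸m≡n; module ≤-Reasoning)
open import Data.Nat.ListAction using (sum)
open import Data.Nat.ListAction.Properties using (sum-++)
open import Data.Nat.Tactic.RingSolver using (solve-∀)
open import Data.List using (replicate)
open import Data.Integer as ℤ using (ℤ; -_; +[1+_]; -[1+_]; _/ℕ_; +≤+; -≤-) renaming (+_ to ℤ+_)
import Data.Integer.Properties as ℤ
open import Data.Integer.DivMod using ([n/ℕd]*d≤n; n<s[n/ℕd]*d)
open import Data.Product using (_,_)
open import Data.Sum using (_⊎_; inj₁; inj₂)
open import Relation.Binary.PropositionalEquality
  using (_≡_; refl; sym; trans; cong; cong₂; subst; module ≡-Reasoning)

ZeroOneTwo : ℤ → Set
ZeroOneTwo k = (k ≡ ℤ+ 0) ⊎ (k ≡ ℤ+ 1) ⊎ (k ≡ ℤ+ 2)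

neg-zeroOneTwo : ∀ k → - ℤ+ 2 ℤ.≤ k → k ℤ.≤ ℤ+ 0 → ZeroOneTwo (- k)
neg-zeroOneTwo (ℤ+ 0)             _              _ = inj₁ refl
neg-zeroOneTwo -[1+ 0 ]           _              _ = inj₂ (inj₁ refl)
neg-zeroOneTwo -[1+ 1 ]           _              _ = inj₂ (inj₂ refl)
neg-zeroOneTwo -[1+ suc (suc _) ] (-≤- (s≤s ())) _
neg-zeroOneTwo +[1+ _ ]           _              (+≤+ ())

module _ (n : ℤ) (d : ℕ) .{{_ : NonZero d}} where

  ≤-/ℕ : ∀ i → i ℤ.* ℤ+ d ℤ.≤ n → i ℤ.≤ n /ℕ d
  ≤-/ℕ i i*d≤n = subst (i ℤ.≤_) (ℤ.pred-suc (n /ℕ d))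
    (ℤ.i<j⇒i≤pred[j] (ℤ.*-cancelʳ-<-nonNeg {i} {ℤ.suc (n /ℕ d)} (ℤ+ d)
      (ℤ.≤-<-trans i*d≤n (n<s[n/ℕd]*d n d))))

  /ℕ-< : ∀ j → n ℤ.< j ℤ.* ℤ+ d → n /ℕ d ℤ.< j
  /ℕ-< j n<j*d = ℤ.*-cancelʳ-<-nonNeg {n /ℕ d} {j} (ℤ+ d) (ℤ.≤-<-trans ([n/ℕd]*d≤n n d) n<j*d)

neg-/ℕ-zeroOneTwo : ∀ n d .{{_ : NonZero d}} → - ℤ+ 2 ℤ.* ℤ+ d ℤ.≤ n → n ℤ.< ℤ+ d →
  ZeroOneTwo (- (n /ℕ d))
neg-/ℕ-zeroOneTwo n d lower upper = neg-zeroOneTwo (n /ℕ d) (≤-/ℕ n d (- ℤ+ 2) lower)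
  (ℤ.i<j⇒i≤pred[j] (/ℕ-< n d (ℤ+ 1) (subst (n ℤ.<_) (sym (ℤ.*-identityˡ (ℤ+ d))) upper)))

neg-/ℕ-difference-zeroOneTwo : ∀ P B d .{{_ : NonZero d}} → P < d → B ≤ 2 * d →
  ZeroOneTwo (- ((ℤ+ P ℤ.- ℤ+ B) /ℕ d))
neg-/ℕ-difference-zeroOneTwo P B d P<d B≤2d = neg-/ℕ-zeroOneTwo (ℤ+ P ℤ.- ℤ+ B) d lower upper
  where
  open ℤ.≤-Reasoning
  lower : - ℤ+ 2 ℤ.* ℤ+ d ℤ.≤ ℤ+ P ℤ.- ℤ+ B
  lower = begin
    - ℤ+ 2 ℤ.* ℤ+ d     ≡⟨ ℤ.neg-distribˡ-* (ℤ+ 2) (ℤ+ d) ⟨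
    - (ℤ+ 2 ℤ.* ℤ+ d)   ≡⟨ cong -_ (ℤ.pos-* 2 d) ⟨
    - ℤ+ (2 * d)        ≤⟨ ℤ.neg-mono-≤ (+≤+ B≤2d) ⟩
    - ℤ+ B              ≤⟨ ℤ.i≤j+i (- ℤ+ B) (ℤ+ P) ⟩
    ℤ+ P ℤ.- ℤ+ B       ∎
  upper : ℤ+ P ℤ.- ℤ+ B ℤ.< ℤ+ d
  upper = ℤ.≤-<-trans (ℤ.i-j≤i (ℤ+ P) (ℤ+ B)) (ℤ.+<+ P<d)

fval-as-difference : ∀ a x v r p q →
  fval a x v r p q ≡ ℤ+ (a * r + x * a * q) ℤ.- ℤ+ ((x * v ∸ 1) * p)
fval-as-difference a x v r p q = begin
  A ℤ.- B ℤ.+ C                ≡⟨ ℤ.+-assoc A (- B) C ⟩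
  A ℤ.+ (- B ℤ.+ C)            ≡⟨ cong (λ t → A ℤ.+ t) (ℤ.+-comm (- B) C) ⟩
  A ℤ.+ (C ℤ.- B)              ≡⟨ ℤ.+-assoc A C (- B) ⟨
  A ℤ.+ C ℤ.- B                ≡⟨ cong (λ t → t ℤ.- B) (ℤ.pos-+ (a * r) (x * a * q)) ⟨
  ℤ+ (a * r + x * a * q) ℤ.- B ∎
  where
  open ≡-Reasoning
  A = ℤ+ (a * r); B = ℤ+ ((x * v ∸ 1) * p); C = ℤ+ (x * a * q)

sum-replicate : ∀ k m → sum (replicate k m) ≡ k * m
sum-replicate zero    m = refl
sum-replicate (suc k) m = cong (m +_) (sum-replicate k m)

size-lam : ∀ a x u w → u ≤ w → size (lam a x u (suc w)) ≡ x * (suc w + a * w)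
size-lam a x u w u≤w with m≤n⇒∃[o]m+o≡n u≤w
... | t , refl = begin
  size (lam a x u (suc w))
    ≡⟨ sum-++ (replicate (u * a + suc w) x) _ ⟩
  sum (replicate (u * a + suc w) x) + sum (replicate (suc w ∸ (u + 1)) (a * x))
    ≡⟨ cong₂ _+_ (sum-replicate (u * a + suc w) x) (sum-replicate (suc w ∸ (u + 1)) (a * x)) ⟩
  (u * a + suc w) * x + (suc w ∸ (u + 1)) * (a * x)
    ≡⟨ cong (λ k → (u * a + suc w) * x + k * (a * x)) extra-parts ⟩
  (u * a + suc w) * x + t * (a * x)
    ≡⟨ collect a x u t ⟩
  x * (suc w + a * w) ∎
  where
  open ≡-Reasoning
  extra-parts : suc w ∸ (u + 1) ≡ t
  extra-parts = trans (cong (suc w ∸_) (+-comm u 1)) (m+n∸m≡n u t)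
  collect : ∀ a x u t → (u * a + suc (u + t)) * x + t * (a * x) ≡ x * (suc (u + t) + a * (u + t))
  collect = solve-∀

module _ (a y s : ℕ) where

  N : ℕ
  N = suc y * (2 + s + a * suc s) ∸ 1

  -- N unfolds definitionally to the truncation-free polynomial on the left of each
  -- identity below, which is what lets the ring solver prove them.
  N-split-positive : N ≡ (a * y + suc y * a * s) + suc (a + suc y * s + 2 * y)
  N-split-positive = identity a y s
    where
    identity : ∀ a y s → suc (s + a * suc s + y * (2 + s + a * suc s))
                       ≡ (a * y + suc y * a * s) + suc (a + suc y * s + 2 * y)
    identity = solve-∀

  2N-split-negative : 2 * N ≡ suc y * (2 + s) * suc a + (suc y * a * s + suc y * s + 2 * y)
  2N-split-negative = identity a y s
    where
    identity : ∀ a y s → 2 * suc (s + a * suc s + y * (2 + s + a * suc s))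
                       ≡ suc y * (2 + s) * suc a + (suc y * a * s + suc y * s + 2 * y)
    identity = solve-∀

  positive-part-< : ∀ r q → r ≤ y → q ≤ s → a * r + suc y * a * q < N
  positive-part-< r q r≤y q≤s = begin-strict
    a * r + suc y * a * q                                  ≤⟨ +-mono-≤ (*-monoʳ-≤ a r≤y) (*-monoʳ-≤ (suc y * a) q≤s) ⟩
    a * y + suc y * a * s                                  <⟨ m<m+n _ z<s ⟩
    (a * y + suc y * a * s) + suc (a + suc y * s + 2 * y)  ≡⟨ N-split-positive ⟨
    N                                                      ∎
    where open ≤-Reasoning

  negative-part-≤ : ∀ p → p ≤ suc a → (suc y * (2 + s) ∸ 1) * p ≤ 2 * N
  negative-part-≤ p p≤1+a = begin
    (suc y * (2 + s) ∸ 1) * p                                      ≤⟨ *-mono-≤ (m∸n≤m (suc y * (2 + s)) 1) p≤1+a ⟩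
    suc y * (2 + s) * suc a                                        ≤⟨ m≤m+n _ _ ⟩
    suc y * (2 + s) * suc a + (suc y * a * s + suc y * s + 2 * y)  ≡⟨ 2N-split-negative ⟨
    2 * N                                                          ∎
    where open ≤-Reasoning

neg-floorDiv-fval-zeroOneTwo : ∀ a x u v r p q → 1 ≤ x → 2 ≤ v → u < v →
  r < x → q < v ∸ 1 → p < 2 + a →
  ZeroOneTwo (- floorDiv (fval a x v r p q) (size (lam a x u v) ∸ 1))
neg-floorDiv-fval-zeroOneTwo a (suc y) u (suc (suc s)) r p q _ _ (s≤s u≤1+s) (s≤s r≤y) (s≤s q≤s) p<2+a
  rewrite size-lam a (suc y) u (suc s) u≤1+s | fval-as-difference a (suc y) (2 + s) r p q =
  neg-/ℕ-difference-zeroOneTwo _ _ _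
    (positive-part-< a y s r q r≤y q≤s) (negative-part-≤ a y s p (≤-pred p<2+a))

proposition4p8 : (a x u v : ℕ) →
    3 ≤ a → a ≤ x → u ≤ a ∸ 3 → u + 2 ≤ v → v ≤ a ∸ 1 → v * x ≤ a * (x ∸ 1) →
    (i : ℕ) → 1 ≤ i → i ≤ size (lam a x u v) ∸ 2 →
    (r p q : ℕ) →
    i ≡ quot (size (lam a x u v)) x * r + ((v ∸ 1) * p + q) →
    r < x → p < a + 2 → q < v ∸ 1 →
    (v ∸ 1) * p + q < quot (size (lam a x u v)) x →
    (p ≡ a + 1 → q ≡ 0) →
    let k = - floorDiv (fval a x v r p q) (size (lam a x u v) ∸ 1) in
    (k ≡ ℤ+ 0) ⊎ (k ≡ ℤ+ 1) ⊎ (k ≡ ℤ+ 2)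
-- Only the ranges of r, p, q enter; the remaining hypotheses (including q = 0 when
-- p = a + 1) are not needed for this bound.
proposition4p8 a x u v 3≤a a≤x _ u+2≤v _ _ _ _ _ r p q _ r<x p<a+2 q<v∸1 _ _ =
  neg-floorDiv-fval-zeroOneTwo a x u v r p q 1≤x 2≤v u<v r<x q<v∸1 (subst (p <_) (+-comm a 2) p<a+2)
  where
  1≤x : 1 ≤ x
  1≤x = ≤-trans (s≤s z≤n) (≤-trans 3≤a a≤x)
  2≤v : 2 ≤ v
  2≤v = ≤-trans (m≤n+m 2 u) u+2≤v
  u<v : u < v
  u<v = ≤-trans (m<m+n u z<s) u+2≤v
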